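{- Let $n\ge 1$ and $N\ge M\ge 1$ be integers and let $A=\{\mathbf a_1,\dots,\mathbf a_N\}\subseteq\mathbb Z^n$, where each $\mathbf a_j=(a_{1j},\dots,a_{n-1,j},1)$ has last coordinate $1$. Put $\beta=\sum_{j=1}^M\mathbf a_j$. Assume that $A'=\{\mathbf a_1,\dots,\mathbf a_M\}$ is minimal for $\sigma_\beta^\circ$. Let $u\in\mathcal M_\beta$ and suppose $u=\sum_{j=1}^N l_j\mathbf a_j$ with $l_j\in\mathbb Z$ for $j=1,\dots,M$ and $l_j\in\mathbb N$ for $j=M+1,\dots,N$. Then $l_j<0$ for all $j=1,\dots,M$, and $l_j=0$ for every $j\in\{M+1,\dots,N\}$ such that $\mathbf a_j\notin\sigma_\beta$.
   Context: $\mathbb N$ denotes the nonnegative integers. $C(A)\subseteq\mathbb R^n$ is the real cone generated by $A$ (all nonnegative real linear combinations of the $\mathbf a_j$). $\sigma_\beta$ is the smallest closed face of $C(A)$ containing $\beta$, and $\sigma_\beta^\circ$ is its relative interior, i.e. $\sigma_\beta$ minus all of its proper closed subfaces (so $\beta\in\sigma_\beta^\circ$). $A'$ is called minimal for $\sigma_\beta^\circ$ if for every proper subset $J\subsetneq\{1,\dots,M\}$ one has $\sum_{j\in J}\mathbf a_j\notin\sigma_\beta^\circ$. $\mathbb ZA\subseteq\mathbb Z^n$ is the subgroup generated by $A$, and $\mathcal M_\beta=(-\sigma_\beta^\circ)\cap\mathbb ZA$. -}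

module Defs where

open import Data.Nat as ℕ using (ℕ; zero; suc)
open import Data.Integer as ℤ using (ℤ; +_)
open import Data.Rational as ℚ using (ℚ; 0ℚ)
open import Data.Fin using (Fin; zero; suc; toℕ)
open import Data.Bool using (Bool; true; false; if_then_else_)
open import Data.Product using (Σ; _×_; ∃)
open import Relation.Binary.PropositionalEquality using (_≡_)

sumℚ : ∀ {k} → (Fin k → ℚ) → ℚ
sumℚ {zero}  f = 0ℚ
sumℚ {suc k} f = f zero ℚ.+ sumℚ (λ i → f (suc i))

sumℤ : ∀ {k} → (Fin k → ℤ) → ℤ
sumℤ {zero}  f = + 0
sumℤ {suc k} f = f zero ℤ.+ sumℤ (λ i → f (suc i))

toℚ : ∀ {n} → (Fin n → ℤ) → (Fin n → ℚ)
toℚ x i = x i ℚ./ 1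

dot : ∀ {n} → (Fin n → ℚ) → (Fin n → ℚ) → ℚ
dot w x = sumℚ (λ i → w i ℚ.* x i)

module Cone {n N : ℕ} (A : Fin N → Fin n → ℤ) where

  InCone : (Fin n → ℚ) → Set
  InCone x = Σ (Fin N → ℚ) λ c →
    (∀ j → 0ℚ ℚ.≤ c j) × (∀ i → x i ≡ sumℚ (λ j → c j ℚ.* toℚ (A j) i))

  -- w defines a supporting hyperplane of C(A) (w ≥ 0 on C(A));
  -- the closed faces of C(A) are the sets  C(A) ∩ {w = 0}  for such w.
  Supporting : (Fin n → ℚ) → Set
  Supporting w = ∀ j → 0ℚ ℚ.≤ dot w (toℚ (A j))

  InFace : (Fin n → ℚ) → (Fin n → ℚ) → Set
  InFace w x = InCone x × dot w x ≡ 0ℚ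

  -- σ_β : the smallest closed face of C(A) containing β,
  -- i.e. the intersection of all closed faces containing β.
  InSigma : (Fin n → ℚ) → (Fin n → ℚ) → Set
  InSigma β x = InCone x × (∀ w → Supporting w → dot w β ≡ 0ℚ → dot w x ≡ 0ℚ)

  -- σ_β° : σ_β minus all its proper closed faces.  A closed face of the
  -- cone σ_β is σ_β ∩ {w = 0} with w ≥ 0 on σ_β; it is proper unless
  -- it contains all of σ_β.
  InRelInt : (Fin n → ℚ) → (Fin n → ℚ) → Set
  InRelInt β x = InSigma β x ×
    (∀ w → (∀ y → InSigma β y → 0ℚ ℚ.≤ dot w y) → dot w x ≡ 0ℚ →
       ∀ y → InSigma β y → dot w y ≡ 0ℚ)

  sumSub : (Fin N → Bool) → Fin n → ℤ
  sumSub J i = sumℤ (λ j → if J j then A j i else + 0)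

  first : ℕ → Fin N → Bool
  first M j = toℕ j ℕ.<ᵇ M

  InLattice : (Fin n → ℤ) → Set
  InLattice u = Σ (Fin N → ℤ) λ k → ∀ i → u i ≡ sumℤ (λ j → k j ℤ.* A j i)

  InMβ : (Fin n → ℚ) → (Fin n → ℤ) → Set
  InMβ β u = InRelInt β (λ i → ℚ.- toℚ u i) × InLattice u

{-# OPTIONS --safe #-}
module Submission where

-- A functional w that is ≥ 0 on a_1, …, a_M and vanishes at β = a_1 + ⋯ + a_M vanishes at each
-- of them; so a_1, …, a_M ∈ σ_β.  Write w(-u) = -Σ l_j w(a_j).  If w supports C(A) and w(β) = 0,
-- then w(-u) = 0 because -u ∈ σ_β, while every term l_j w(a_j) is ≥ 0; hence all terms vanish and
-- a_j ∈ σ_β whenever l_j > 0, which is the second claim.  For the first, let S = {j ≤ M : l_j < 0}.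
-- If w ≥ 0 on σ_β vanishes at Σ_{j∈S} a_j, it vanishes at the a_j with l_j < 0 and is ≥ 0 at those
-- with l_j > 0, so w(-u) ≤ 0, hence w(-u) = 0 and, as -u ∈ σ_β°, w vanishes on σ_β.  Thus
-- Σ_{j∈S} a_j ∈ σ_β°, and minimality of A' forces S = {1, …, M}.  The hypotheses 1 ≤ M ≤ N and
-- that all last coordinates equal 1 play no role.

open import Defs
open import Data.Nat as ℕ using (ℕ; zero; suc)
import Data.Nat.Properties as ℕP
open import Data.Integer as ℤ using (ℤ; +_)
import Data.Integer.Properties as ℤP
open import Data.Rational as ℚ using (ℚ; 0ℚ; 1ℚ; toℚᵘ)
import Data.Rational.Properties as ℚP
open import Data.Rational.Unnormalised as ℚᵘ using (mkℚᵘ) renaming (_≃_ to _≃ᵘ_)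
import Data.Rational.Unnormalised.Properties as ℚᵘP
open import Data.Fin using (Fin; zero; suc; toℕ; fromℕ)
open import Data.Fin.Properties using (_≟_)
open import Data.Bool using (Bool; true; false; if_then_else_; _∧_)
open import Data.Bool.Properties using (T-≡; ∧-conicalˡ; ∧-zeroʳ)
open import Data.Product using (Σ; _×_; _,_; proj₁; proj₂)
open import Function using (_∘_; Equivalence)
open import Relation.Nullary using (¬_; yes; no)
open import Relation.Nullary.Decidable using (does; dec-true; dec-false; decidable-stable)
open import Relation.Binary.Definitions using (tri<; tri≈; tri>)
open import Relation.Binary.PropositionalEquality
open import Algebra.Bundles using (Ring; CommutativeMonoid)
open import Algebra.Properties.Semiring.Sum (Ring.semiring ℚP.+-*-ring)
  using (sum; ∑-distrib-+; *-distribˡ-sum; sum-cong-≗; sum-replicate-zero)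
open import Algebra.Properties.CommutativeSemigroup
  (CommutativeMonoid.commutativeSemigroup ℚP.*-1-commutativeMonoid) using (x∙yz≈y∙xz)

fromℤ : ℤ → ℚ
fromℤ i = i ℚ./ 1

toℚᵘ-fromℤ : ∀ i → toℚᵘ (fromℤ i) ≃ᵘ mkℚᵘ i 0
toℚᵘ-fromℤ i = ℚP.toℚᵘ-fromℚᵘ (mkℚᵘ i 0)

fromℤ-+ : ∀ i j → fromℤ (i ℤ.+ j) ≡ fromℤ i ℚ.+ fromℤ j
fromℤ-+ i j = ℚP.toℚᵘ-injective (begin
    toℚᵘ (fromℤ (i ℤ.+ j))               ≈⟨ toℚᵘ-fromℤ (i ℤ.+ j) ⟩
    mkℚᵘ (i ℤ.+ j) 0                      ≈⟨ ℚᵘ.*≡* (cong (ℤ._* + 1) i+j≡i*1+j*1) ⟩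
    mkℚᵘ i 0 ℚᵘ.+ mkℚᵘ j 0                ≈⟨ ℚᵘP.+-cong (toℚᵘ-fromℤ i) (toℚᵘ-fromℤ j) ⟨
    toℚᵘ (fromℤ i) ℚᵘ.+ toℚᵘ (fromℤ j)   ≈⟨ ℚP.toℚᵘ-homo-+ (fromℤ i) (fromℤ j) ⟨
    toℚᵘ (fromℤ i ℚ.+ fromℤ j)           ∎)
  where
  open ℚᵘP.≃-Reasoning
  i+j≡i*1+j*1 : i ℤ.+ j ≡ i ℤ.* + 1 ℤ.+ j ℤ.* + 1
  i+j≡i*1+j*1 = sym (cong₂ ℤ._+_ (ℤP.*-identityʳ i) (ℤP.*-identityʳ j))

fromℤ-* : ∀ i j → fromℤ (i ℤ.* j) ≡ fromℤ i ℚ.* fromℤ j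
fromℤ-* i j = ℚP.toℚᵘ-injective (begin
    toℚᵘ (fromℤ (i ℤ.* j))               ≈⟨ toℚᵘ-fromℤ (i ℤ.* j) ⟩
    mkℚᵘ i 0 ℚᵘ.* mkℚᵘ j 0                ≈⟨ ℚᵘP.*-cong (toℚᵘ-fromℤ i) (toℚᵘ-fromℤ j) ⟨
    toℚᵘ (fromℤ i) ℚᵘ.* toℚᵘ (fromℤ j)   ≈⟨ ℚP.toℚᵘ-homo-* (fromℤ i) (fromℤ j) ⟨
    toℚᵘ (fromℤ i ℚ.* fromℤ j)           ∎)
  where open ℚᵘP.≃-Reasoning

fromℤ-sumℤ : ∀ {k} (f : Fin k → ℤ) → fromℤ (sumℤ f) ≡ sumℚ (fromℤ ∘ f)
fromℤ-sumℤ {zero}  f = refl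
fromℤ-sumℤ {suc k} f = trans (fromℤ-+ (f zero) _)
  (cong (fromℤ (f zero) ℚ.+_) (fromℤ-sumℤ (f ∘ suc)))

fromℤ-*-nonNeg : ∀ {i q} → + 0 ℤ.≤ i → 0ℚ ℚ.≤ q → 0ℚ ℚ.≤ fromℤ i ℚ.* q
fromℤ-*-nonNeg {+ n} {q} _ 0≤q = subst (ℚ._≤ fromℤ (+ n) ℚ.* q) (ℚP.*-zeroʳ (fromℤ (+ n)))
  (ℚP.*-monoˡ-≤-nonNeg (fromℤ (+ n)) {{ℚP.normalize-nonNeg n 1}} 0≤q)

fromℤ-pos-*≡0⇒≡0 : ∀ {i q} → + 0 ℤ.< i → fromℤ i ℚ.* q ≡ 0ℚ → q ≡ 0ℚ
fromℤ-pos-*≡0⇒≡0 {+ m} {q} (ℤ.+<+ 0<m) mq≡0 = ℚP.≤-antisym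
  (ℚP.*-cancelˡ-≤-pos r (ℚP.≤-reflexive (trans mq≡0 (sym (ℚP.*-zeroʳ r)))))
  (ℚP.*-cancelˡ-≤-pos r (ℚP.≤-reflexive (trans (ℚP.*-zeroʳ r) (sym mq≡0))))
  where
  r = fromℤ (+ m)
  instance _ = ℚP.normalize-pos m 1 {{_}} {{ℕ.>-nonZero 0<m}}

q≡0⇒0≤p*q : ∀ p {q} → q ≡ 0ℚ → 0ℚ ℚ.≤ p ℚ.* q
q≡0⇒0≤p*q p refl = ℚP.≤-reflexive (sym (ℚP.*-zeroʳ p))

sumℚ≡sum : ∀ {k} (f : Fin k → ℚ) → sumℚ f ≡ sum f
sumℚ≡sum {zero}  f = refl
sumℚ≡sum {suc k} f = cong (f zero ℚ.+_) (sumℚ≡sum (f ∘ suc))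

sumℚ-cong : ∀ {k} {f g : Fin k → ℚ} → (∀ i → f i ≡ g i) → sumℚ f ≡ sumℚ g
sumℚ-cong {f = f} {g} f≗g rewrite sumℚ≡sum f | sumℚ≡sum g = sum-cong-≗ f≗g

sumℚ-zero : ∀ {k} (f : Fin k → ℚ) → (∀ i → f i ≡ 0ℚ) → sumℚ f ≡ 0ℚ
sumℚ-zero {k} f f≗0 rewrite sumℚ≡sum f = trans (sum-cong-≗ f≗0) (sum-replicate-zero k)

sumℚ-distrib-+ : ∀ {k} (f g : Fin k → ℚ) → sumℚ (λ i → f i ℚ.+ g i) ≡ sumℚ f ℚ.+ sumℚ g
sumℚ-distrib-+ f g rewrite sumℚ≡sum f | sumℚ≡sum g | sumℚ≡sum (λ i → f i ℚ.+ g i) = ∑-distrib-+ f g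

*-distribˡ-sumℚ : ∀ {k} x (f : Fin k → ℚ) → x ℚ.* sumℚ f ≡ sumℚ (λ i → x ℚ.* f i)
*-distribˡ-sumℚ x f rewrite sumℚ≡sum f | sumℚ≡sum (λ i → x ℚ.* f i) = *-distribˡ-sum x f

neg-distrib-sumℚ : ∀ {k} (f : Fin k → ℚ) → ℚ.- sumℚ f ≡ sumℚ (λ i → ℚ.- f i)
neg-distrib-sumℚ {zero}  f = refl
neg-distrib-sumℚ {suc k} f = trans (ℚP.neg-distrib-+ (f zero) _)
  (cong (ℚ.- f zero ℚ.+_) (neg-distrib-sumℚ (f ∘ suc)))

sumℚ-nonNeg : ∀ {k} (f : Fin k → ℚ) → (∀ i → 0ℚ ℚ.≤ f i) → 0ℚ ℚ.≤ sumℚ f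
sumℚ-nonNeg {zero}  f f≥0 = ℚP.≤-refl
sumℚ-nonNeg {suc k} f f≥0 = ℚP.+-mono-≤ (f≥0 zero) (sumℚ-nonNeg (f ∘ suc) (f≥0 ∘ suc))

term≤sumℚ : ∀ {k} (f : Fin k → ℚ) → (∀ i → 0ℚ ℚ.≤ f i) → ∀ i → f i ℚ.≤ sumℚ f
term≤sumℚ f f≥0 zero = subst (ℚ._≤ sumℚ f) (ℚP.+-identityʳ (f zero))
  (ℚP.+-monoʳ-≤ (f zero) (sumℚ-nonNeg (f ∘ suc) (f≥0 ∘ suc)))
term≤sumℚ f f≥0 (suc i) = ℚP.≤-trans (term≤sumℚ (f ∘ suc) (f≥0 ∘ suc) i)
  (subst (ℚ._≤ sumℚ f) (ℚP.+-identityˡ (sumℚ (f ∘ suc)))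
    (ℚP.+-monoˡ-≤ (sumℚ (f ∘ suc)) (f≥0 zero)))

sumℚ-nonNeg-≡0 : ∀ {k} (f : Fin k → ℚ) → (∀ i → 0ℚ ℚ.≤ f i) → sumℚ f ≡ 0ℚ → ∀ i → f i ≡ 0ℚ
sumℚ-nonNeg-≡0 f f≥0 Σ≡0 i =
  ℚP.≤-antisym (ℚP.≤-trans (term≤sumℚ f f≥0 i) (ℚP.≤-reflexive Σ≡0)) (f≥0 i)

𝟙 : Bool → ℚ
𝟙 b = if b then 1ℚ else 0ℚ

𝟙-nonNeg : ∀ b → 0ℚ ℚ.≤ 𝟙 b
𝟙-nonNeg true  = ℚP.nonNegative⁻¹ 1ℚ
𝟙-nonNeg false = ℚP.≤-refl

sumℚ-𝟙≟ : ∀ {k} (j : Fin k) (f : Fin k → ℚ) → sumℚ (λ i → 𝟙 (does (i ≟ j)) ℚ.* f i) ≡ f j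
sumℚ-𝟙≟ zero f = begin
    1ℚ ℚ.* f zero ℚ.+ sumℚ (λ i → 0ℚ ℚ.* f (suc i))
      ≡⟨ cong₂ ℚ._+_ (ℚP.*-identityˡ (f zero)) (sumℚ-zero _ (ℚP.*-zeroˡ ∘ f ∘ suc)) ⟩
    f zero ℚ.+ 0ℚ
      ≡⟨ ℚP.+-identityʳ (f zero) ⟩
    f zero ∎
  where open ≡-Reasoning
sumℚ-𝟙≟ (suc j) f = begin
    0ℚ ℚ.* f zero ℚ.+ sumℚ (λ i → 𝟙 (does (i ≟ j)) ℚ.* f (suc i))
      ≡⟨ cong (ℚ._+ sumℚ (λ i → 𝟙 (does (i ≟ j)) ℚ.* f (suc i))) (ℚP.*-zeroˡ (f zero)) ⟩
    0ℚ ℚ.+ sumℚ (λ i → 𝟙 (does (i ≟ j)) ℚ.* f (suc i))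
      ≡⟨ ℚP.+-identityˡ _ ⟩
    sumℚ (λ i → 𝟙 (does (i ≟ j)) ℚ.* f (suc i))
      ≡⟨ sumℚ-𝟙≟ j (f ∘ suc) ⟩
    f (suc j) ∎
  where open ≡-Reasoning

fromℤ-if : ∀ b i → fromℤ (if b then i else + 0) ≡ 𝟙 b ℚ.* fromℤ i
fromℤ-if true  i = sym (ℚP.*-identityˡ (fromℤ i))
fromℤ-if false i = sym (ℚP.*-zeroˡ (fromℤ i))

dot-zero : ∀ {n} (w : Fin n → ℚ) → dot w (toℚ (λ _ → + 0)) ≡ 0ℚ
dot-zero w = sumℚ-zero _ (ℚP.*-zeroʳ ∘ w)

dot-+ : ∀ {n} (w : Fin n → ℚ) (x y : Fin n → ℤ) →
  dot w (toℚ (λ i → x i ℤ.+ y i)) ≡ dot w (toℚ x) ℚ.+ dot w (toℚ y)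
dot-+ w x y = trans
  (sumℚ-cong (λ i → trans (cong (w i ℚ.*_) (fromℤ-+ (x i) (y i)))
                          (ℚP.*-distribˡ-+ (w i) (fromℤ (x i)) (fromℤ (y i)))))
  (sumℚ-distrib-+ (λ i → w i ℚ.* fromℤ (x i)) (λ i → w i ℚ.* fromℤ (y i)))

dot-* : ∀ {n} (w : Fin n → ℚ) (c : ℤ) (x : Fin n → ℤ) →
  dot w (toℚ (λ i → c ℤ.* x i)) ≡ fromℤ c ℚ.* dot w (toℚ x)
dot-* w c x = trans
  (sumℚ-cong (λ i → trans (cong (w i ℚ.*_) (fromℤ-* c (x i))) (x∙yz≈y∙xz (w i) (fromℤ c) _)))
  (sym (*-distribˡ-sumℚ (fromℤ c) (λ i → w i ℚ.* fromℤ (x i))))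

dot-if : ∀ {n} (w : Fin n → ℚ) (b : Bool) (x : Fin n → ℤ) →
  dot w (toℚ (λ i → if b then x i else + 0)) ≡ (if b then dot w (toℚ x) else 0ℚ)
dot-if w true  x = refl
dot-if w false x = dot-zero w

dot-neg : ∀ {n} (w x : Fin n → ℚ) → dot w (λ i → ℚ.- x i) ≡ ℚ.- dot w x
dot-neg w x = trans (sumℚ-cong (λ i → sym (ℚP.neg-distribʳ-* (w i) (x i))))
  (sym (neg-distrib-sumℚ (λ i → w i ℚ.* x i)))

dot-sumℤ : ∀ {n N} (w : Fin n → ℚ) (F : Fin N → Fin n → ℤ) →
  dot w (toℚ (λ i → sumℤ (λ j → F j i))) ≡ sumℚ (λ j → dot w (toℚ (F j)))
dot-sumℤ {N = zero}  w F = dot-zero w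
dot-sumℤ {N = suc N} w F = trans (dot-+ w (F zero) _)
  (cong (dot w (toℚ (F zero)) ℚ.+_) (dot-sumℤ w (F ∘ suc)))

<⇒<ᵇ≡true : ∀ {m n} → m ℕ.< n → (m ℕ.<ᵇ n) ≡ true
<⇒<ᵇ≡true m<n = Equivalence.to T-≡ (ℕP.<⇒<ᵇ m<n)

<ᵇ≡true⇒< : ∀ {m n} → (m ℕ.<ᵇ n) ≡ true → m ℕ.< n
<ᵇ≡true⇒< {m} {n} m<ᵇn = ℕP.<ᵇ⇒< m n (Equivalence.from T-≡ m<ᵇn)

module _ {n N : ℕ} (A : Fin N → Fin n → ℤ) where
  open Cone A

  a : Fin N → Fin n → ℚ
  a j = toℚ (A j)

  column-inCone : ∀ j → InCone (a j)
  column-inCone j = (λ j′ → 𝟙 (does (j′ ≟ j))) , (λ j′ → 𝟙-nonNeg _) ,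
    λ i → sym (sumℚ-𝟙≟ j (λ j′ → a j′ i))

  sumSub-inCone : ∀ J → InCone (toℚ (sumSub J))
  sumSub-inCone J = 𝟙 ∘ J , 𝟙-nonNeg ∘ J ,
    λ i → trans (fromℤ-sumℤ (λ j → if J j then A j i else + 0))
                (sumℚ-cong (λ j → fromℤ-if (J j) (A j i)))

  dot-sumSub : ∀ w J → dot w (toℚ (sumSub J)) ≡ sumℚ (λ j → if J j then dot w (a j) else 0ℚ)
  dot-sumSub w J = trans (dot-sumℤ w (λ j i → if J j then A j i else + 0))
    (sumℚ-cong (λ j → dot-if w (J j) (A j)))

  dot-combination : ∀ w (c : Fin N → ℤ) →
    dot w (toℚ (λ i → sumℤ (λ j → c j ℤ.* A j i))) ≡ sumℚ (λ j → fromℤ (c j) ℚ.* dot w (a j))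
  dot-combination w c = trans (dot-sumℤ w (λ j i → c j ℤ.* A j i))
    (sumℚ-cong (λ j → dot-* w (c j) (A j)))

  dot-sumSub≡0⇒dot≡0 : ∀ w J → (∀ j → J j ≡ true → 0ℚ ℚ.≤ dot w (a j)) →
    dot w (toℚ (sumSub J)) ≡ 0ℚ → ∀ j → J j ≡ true → dot w (a j) ≡ 0ℚ
  dot-sumSub≡0⇒dot≡0 w J nonNeg wΣ≡0 j j∈J =
    subst (λ b → (if b then dot w (a j) else 0ℚ) ≡ 0ℚ) j∈J
      (sumℚ-nonNeg-≡0 _ terms-nonNeg (trans (sym (dot-sumSub w J)) wΣ≡0) j)
    where
    terms-nonNeg : ∀ j → 0ℚ ℚ.≤ (if J j then dot w (a j) else 0ℚ)
    terms-nonNeg j with J j in j∈J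
    ... | true  = nonNeg j j∈J
    ... | false = ℚP.≤-refl

  module _ (M : ℕ) where
    β : Fin n → ℚ
    β = toℚ (sumSub (first M))

    Minimal : Set
    Minimal = ∀ (J : Fin N → Bool) → (∀ j → J j ≡ true → toℕ j ℕ.< M) →
      Σ (Fin N) (λ j → toℕ j ℕ.< M × J j ≡ false) → ¬ InRelInt β (toℚ (sumSub J))

    supporting-β⇒dot≡0 : ∀ w → Supporting w → dot w β ≡ 0ℚ → ∀ j → toℕ j ℕ.< M → dot w (a j) ≡ 0ℚ
    supporting-β⇒dot≡0 w supp wβ≡0 j j<M =
      dot-sumSub≡0⇒dot≡0 w (first M) (λ j _ → supp j) wβ≡0 j (<⇒<ᵇ≡true j<M)

    column-inSigma : ∀ j → toℕ j ℕ.< M → InSigma β (a j)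
    column-inSigma j j<M = column-inCone j , λ w supp wβ≡0 → supporting-β⇒dot≡0 w supp wβ≡0 j j<M

    sumSub-inSigma : ∀ J → (∀ j → J j ≡ true → toℕ j ℕ.< M) → InSigma β (toℚ (sumSub J))
    sumSub-inSigma J J⊆first = sumSub-inCone J ,
      λ w supp wβ≡0 → trans (dot-sumSub w J) (sumℚ-zero _ (terms≡0 w supp wβ≡0))
      where
      terms≡0 : ∀ w → Supporting w → dot w β ≡ 0ℚ → ∀ j → (if J j then dot w (a j) else 0ℚ) ≡ 0ℚ
      terms≡0 w supp wβ≡0 j with J j in j∈J
      ... | true  = supporting-β⇒dot≡0 w supp wβ≡0 j (J⊆first j j∈J)
      ... | false = refl

    module Coefficients (u : Fin n → ℤ) (u∈Mβ : InMβ β u) (l : Fin N → ℤ)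
                        (l≥0 : ∀ j → M ℕ.≤ toℕ j → + 0 ℤ.≤ l j)
                        (u≡Σla : ∀ i → u i ≡ sumℤ (λ j → l j ℤ.* A j i)) where

      -u : Fin n → ℚ
      -u i = ℚ.- toℚ u i

      -u∈σ : InSigma β -u
      -u∈σ = proj₁ (proj₁ u∈Mβ)

      dot-neg-u : ∀ w → dot w -u ≡ ℚ.- sumℚ (λ j → fromℤ (l j) ℚ.* dot w (a j))
      dot-neg-u w = trans (dot-neg w (toℚ u)) (cong ℚ.-_ (trans
        (sumℚ-cong (λ i → cong (λ z → w i ℚ.* fromℤ z) (u≡Σla i))) (dot-combination w l)))

      negative⇒<M : ∀ j → l j ℤ.< + 0 → toℕ j ℕ.< M
      negative⇒<M j l<0 = decidable-stable (toℕ j ℕ.<? M)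
        (λ j≮M → ℤP.<⇒≱ l<0 (l≥0 j (ℕP.≮⇒≥ j≮M)))

      positive⇒inSigma : ∀ j → + 0 ℤ.< l j → InSigma β (a j)
      positive⇒inSigma j 0<l = column-inCone j ,
        λ w supp wβ≡0 → fromℤ-pos-*≡0⇒≡0 0<l (sumℚ-nonNeg-≡0 _ (terms-nonNeg w supp wβ≡0)
          (ℚP.neg-injective (trans (sym (dot-neg-u w)) (proj₂ -u∈σ w supp wβ≡0))) j)
        where
        terms-nonNeg : ∀ w → Supporting w → dot w β ≡ 0ℚ →
          ∀ j → 0ℚ ℚ.≤ fromℤ (l j) ℚ.* dot w (a j)
        terms-nonNeg w supp wβ≡0 j with toℕ j ℕ.<? M
        ... | yes j<M = q≡0⇒0≤p*q (fromℤ (l j)) (supporting-β⇒dot≡0 w supp wβ≡0 j j<M)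
        ... | no  j≮M = fromℤ-*-nonNeg (l≥0 j (ℕP.≮⇒≥ j≮M)) (supp j)

      outside-σ⇒≡0 : ∀ j → M ℕ.≤ toℕ j → ¬ InSigma β (a j) → l j ≡ + 0
      outside-σ⇒≡0 j M≤j a∉σ = decidable-stable (l j ℤ.≟ + 0)
        (λ l≢0 → a∉σ (positive⇒inSigma j (ℤP.≤∧≢⇒< (l≥0 j M≤j) (l≢0 ∘ sym))))

      S : Fin N → Bool
      S j = first M j ∧ does (l j ℤ.<? + 0)

      S⊆first : ∀ j → S j ≡ true → toℕ j ℕ.< M
      S⊆first j j∈S = <ᵇ≡true⇒< (∧-conicalˡ _ _ j∈S)

      dot-neg-u≡0 : ∀ w → (∀ y → InSigma β y → 0ℚ ℚ.≤ dot w y) →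
        dot w (toℚ (sumSub S)) ≡ 0ℚ → dot w -u ≡ 0ℚ
      dot-neg-u≡0 w w≥0 wS≡0 = ℚP.≤-antisym
        (ℚP.≤-trans (ℚP.≤-reflexive (dot-neg-u w)) (ℚP.neg-antimono-≤ (sumℚ-nonNeg _ terms-nonNeg)))
        (w≥0 -u -u∈σ)
        where
        terms-nonNeg : ∀ j → 0ℚ ℚ.≤ fromℤ (l j) ℚ.* dot w (a j)
        terms-nonNeg j with ℤP.<-cmp (l j) (+ 0)
        ... | tri< l<0 _ _ = q≡0⇒0≤p*q (fromℤ (l j)) wa≡0
          where
          j∈S : S j ≡ true
          j∈S = cong₂ _∧_ (<⇒<ᵇ≡true (negative⇒<M j l<0)) (dec-true (l j ℤ.<? + 0) l<0)
          wa≡0 : dot w (a j) ≡ 0ℚ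
          wa≡0 = dot-sumSub≡0⇒dot≡0 w S (λ j j∈S → w≥0 _ (column-inSigma j (S⊆first j j∈S)))
            wS≡0 j j∈S
        ... | tri≈ _ l≡0 _ rewrite l≡0 = ℚP.≤-reflexive (sym (ℚP.*-zeroˡ (dot w (a j))))
        ... | tri> _ _ 0<l = fromℤ-*-nonNeg (ℤP.<⇒≤ 0<l) (w≥0 _ (positive⇒inSigma j 0<l))

      S-inRelInt : InRelInt β (toℚ (sumSub S))
      S-inRelInt = sumSub-inSigma S S⊆first ,
        λ w w≥0 wS≡0 → proj₂ (proj₁ u∈Mβ) w w≥0 (dot-neg-u≡0 w w≥0 wS≡0)

      first⇒negative : Minimal → ∀ j → toℕ j ℕ.< M → l j ℤ.< + 0
      first⇒negative minimal j j<M = decidable-stable (l j ℤ.<? + 0)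
        (λ l≮0 → minimal S S⊆first (j , j<M , j∉S l≮0) S-inRelInt)
        where
        j∉S : ¬ l j ℤ.< + 0 → S j ≡ false
        j∉S l≮0 = trans (cong (first M j ∧_) (dec-false (l j ℤ.<? + 0) l≮0)) (∧-zeroʳ _)

lemma2p1 : (k N M : ℕ) → 1 ℕ.≤ M → M ℕ.≤ N →
  (A : Fin N → Fin (suc k) → ℤ) →
  (∀ j → A j (fromℕ k) ≡ + 1) →
  let open Cone A
      β = toℚ (sumSub (first M))
  in
  (∀ (J : Fin N → Bool) → (∀ j → J j ≡ true → toℕ j ℕ.< M) →
     Σ (Fin N) (λ j → toℕ j ℕ.< M × J j ≡ false) →
     ¬ InRelInt β (toℚ (sumSub J))) →
  (u : Fin (suc k) → ℤ) → InMβ β u →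
  (l : Fin N → ℤ) →
  (∀ j → M ℕ.≤ toℕ j → + 0 ℤ.≤ l j) →
  (∀ i → u i ≡ sumℤ (λ j → l j ℤ.* A j i)) →
  (∀ j → toℕ j ℕ.< M → l j ℤ.< + 0) ×
  (∀ j → M ℕ.≤ toℕ j → ¬ InSigma β (toℚ (A j)) → l j ≡ + 0)
lemma2p1 k N M _ _ A _ minimal u u∈Mβ l l≥0 u≡Σla =
  first⇒negative minimal , outside-σ⇒≡0
  where open Coefficients A M u u∈Mβ l l≥0 u≡Σla
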